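{- Let $\tau\ge 2$ and $e\ge 1$ be integers. Define $r_3$ and $r_2$ as follows. - If $\tau$ is even: $r_3=2\cdot3^{\tau-1}+1$ and $r_2=\frac{2^e(2^\tau+1)+1}{3}$ when $e$ is even; $r_3=1$ and $r_2=\frac{2^e+1}{3}$ when $e$ is odd. - If $\tau$ is odd: $r_3=3^{\tau-1}+1$ and $r_2=\frac{2^e(2^{\tau-1}+1)+1}{3}$ when $e$ is even; $r_3=1$ and $r_2=\frac{2^e+1}{3}$ when $e$ is odd. Then $r_3=r_2$ if and only if either $e=1$, or $e=\tau=2$. -}

module Defs where

open import Data.Nat using (ℕ; _+_; _*_; _∸_; _^_; _/_; _%_; _≡ᵇ_)
open import Data.Bool using (Bool; true; false; if_then_else_)

even : ℕ → Bool
even n = (n % 2) ≡ᵇ 0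

-- r₃ τ e and r₂ τ e as defined in the paper.
-- The divisions by 3 are exact in every case (numerators are ≡ 0 mod 3),
-- so ℕ floor division _/_ agrees with the paper's rational quotient.

r₃ : ℕ → ℕ → ℕ
r₃ τ e = if even e
           then (if even τ then 2 * 3 ^ (τ ∸ 1) + 1 else 3 ^ (τ ∸ 1) + 1)
           else 1

r₂ : ℕ → ℕ → ℕ
r₂ τ e = if even e
           then (if even τ then (2 ^ e * (2 ^ τ + 1) + 1) / 3
                           else (2 ^ e * (2 ^ (τ ∸ 1) + 1) + 1) / 3)
           else (2 ^ e + 1) / 3

{-# OPTIONS --safe #-}

-- For odd e ≥ 3 we have r₂ ≥ (2³ + 1)/3 = 3 > 1 = r₃.
-- For even e = 2k, with 2l the even one of τ and τ - 1, the numerator of r₂ is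
-- 4^k (4^l + 1) + 1, divisible by 3 because 4 ≡ 1 (mod 3), so r₃ = r₂ clears
-- to 3 r₃ = 4^k (4^l + 1) + 1.
-- For odd τ the left side 3 (9^l + 1) is even while the right side is odd.
-- For even τ the left side 3 (2·3^(τ-1) + 1) is 5 mod 8 as 3^(τ-1) ≡ 3 (mod 8),
-- whereas the right side is 1 mod 8 as soon as e ≥ 4; for e = 2 the equation
-- becomes 9^s = 2·4^s + 1 with τ = 2s, and 9^s outgrows 2·4^s + 1 once s ≥ 2.

module Submission where

open import Defs
open import Data.Bool using (true; false)
open import Data.Empty using (⊥-elim)
open import Data.List using (_∷_; [])
open import Data.Nat using (ℕ; zero; suc; _+_; _*_; _^_; _/_; _%_; _≤_; _<_; z≤n; s≤s; NonZero)
open import Data.Nat.Divisibility using (_∣_; divides)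
open import Data.Nat.DivMod using (m*[n/m]≡n; [m+kn]%n≡m%n; m<n⇒m%n≡m; /-monoˡ-≤)
open import Data.Nat.Properties
open import Data.Nat.Tactic.RingSolver using (solve-∀; solve)
open import Data.Product using (_×_; _,_; ∃-syntax)
open import Data.Sum using (_⊎_; inj₁; inj₂)
open import Function using (_∘_)
open import Function.Bundles using (_⇔_; mk⇔)
open import Relation.Nullary using (contradiction)
open import Relation.Binary.PropositionalEquality using (_≡_; _≢_; refl; sym; trans; cong; cong₂; module ≡-Reasoning)

-- Recursive rather than 2 * k, so that parity and powers unfold along k.
double : ℕ → ℕ
double zero    = zero
double (suc k) = suc (suc (double k))

data Parity : ℕ → Set where
  twice   : ∀ k → Parity (double k)
  twice+1 : ∀ k → Parity (suc (double k))

parity : ∀ n → Parity n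
parity zero = twice zero
parity (suc n) with parity n
... | twice k   = twice+1 k
... | twice+1 k = twice (suc k)

even-double : ∀ k → even (double k) ≡ true
even-double zero    = refl
even-double (suc k) = even-double k

even-suc-double : ∀ k → even (suc (double k)) ≡ false
even-suc-double zero    = refl
even-suc-double (suc k) = even-suc-double k

^-double : ∀ m k → m ^ double k ≡ (m * m) ^ k
^-double m zero    = refl
^-double m (suc k) rewrite ^-double m k = sym (*-assoc m m _)

[1+q]^n≡1[mod-q] : ∀ q n → ∃[ a ] suc q ^ n ≡ 1 + q * a
[1+q]^n≡1[mod-q] q zero = 0 , cong suc (sym (*-zeroʳ q))
[1+q]^n≡1[mod-q] q (suc n) with [1+q]^n≡1[mod-q] q n
... | a , eq = 1 + a + q * a , (begin
  suc q * suc q ^ n   ≡⟨ cong (suc q *_) eq ⟩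
  suc q * (1 + q * a) ≡⟨ solve (q ∷ a ∷ []) ⟩
  1 + q * (1 + a + q * a) ∎)
  where open ≡-Reasoning

m+kn≡o+ln⇒m≡o : ∀ {m o} k l n .{{_ : NonZero n}} → m < n → o < n → m + k * n ≡ o + l * n → m ≡ o
m+kn≡o+ln⇒m≡o {m} {o} k l n m<n o<n eq = begin
  m               ≡⟨ m<n⇒m%n≡m m<n ⟨
  m % n           ≡⟨ [m+kn]%n≡m%n m k n ⟨
  (m + k * n) % n ≡⟨ cong (_% n) eq ⟩
  (o + l * n) % n ≡⟨ [m+kn]%n≡m%n o l n ⟩
  o % n           ≡⟨ m<n⇒m%n≡m o<n ⟩
  o               ∎
  where open ≡-Reasoning

3∣4^k*[4^l+1]+1 : ∀ k l → 3 ∣ 4 ^ k * (4 ^ l + 1) + 1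
3∣4^k*[4^l+1]+1 k l with [1+q]^n≡1[mod-q] 3 k | [1+q]^n≡1[mod-q] 3 l
... | a , 4^k≡ | b , 4^l≡ = divides (1 + 2 * a + b + 3 * a * b) (begin
  4 ^ k * (4 ^ l + 1) + 1           ≡⟨ cong₂ (λ x y → x * (y + 1) + 1) 4^k≡ 4^l≡ ⟩
  (1 + 3 * a) * (1 + 3 * b + 1) + 1 ≡⟨ solve (a ∷ b ∷ []) ⟩
  (1 + 2 * a + b + 3 * a * b) * 3   ∎)
  where open ≡-Reasoning

3*[2^2k*[2^2l+1]+1]/3 : ∀ k l → 3 * ((2 ^ double k * (2 ^ double l + 1) + 1) / 3) ≡ 4 ^ k * (4 ^ l + 1) + 1
3*[2^2k*[2^2l+1]+1]/3 k l = begin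
  3 * ((2 ^ double k * (2 ^ double l + 1) + 1) / 3)
    ≡⟨ cong₂ (λ x y → 3 * ((x * (y + 1) + 1) / 3)) (^-double 2 k) (^-double 2 l) ⟩
  3 * ((4 ^ k * (4 ^ l + 1) + 1) / 3)
    ≡⟨ m*[n/m]≡n (3∣4^k*[4^l+1]+1 k l) ⟩
  4 ^ k * (4 ^ l + 1) + 1 ∎
  where open ≡-Reasoning

2*4^n+1<9^n : ∀ {n} → 2 ≤ n → 2 * 4 ^ n + 1 < 9 ^ n
2*4^n+1<9^n {suc (suc n)} (s≤s (s≤s z≤n)) = begin-strict
  2 * (4 * (4 * 4 ^ n)) + 1 ≡⟨ cong (_+ 1) (trans (*-assoc 8 4 (4 ^ n)) (*-assoc 2 4 (4 * 4 ^ n))) ⟨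
  32 * 4 ^ n + 1            <⟨ +-monoʳ-< (32 * 4 ^ n) 1<49*4^n ⟩
  32 * 4 ^ n + 49 * 4 ^ n   ≡⟨ *-distribʳ-+ (4 ^ n) 32 49 ⟨
  81 * 4 ^ n                ≤⟨ *-monoʳ-≤ 81 (^-monoˡ-≤ n (m≤m+n 4 5)) ⟩
  81 * 9 ^ n                ≡⟨ *-assoc 9 9 (9 ^ n) ⟩
  9 * (9 * 9 ^ n)           ∎
  where
  open ≤-Reasoning
  1<49*4^n : 1 < 49 * 4 ^ n
  1<49*4^n = ≤-trans (m≤m+n 2 47) (*-monoʳ-≤ 49 (m^n>0 4 n))

r₃≢r₂-odd-e : ∀ τ e → even e ≡ false → 3 ≤ e → r₃ τ e ≢ r₂ τ e
r₃≢r₂-odd-e τ e e-odd 3≤e rewrite e-odd =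
  <⇒≢ (<-≤-trans (s≤s (s≤s z≤n)) (/-monoˡ-≤ 3 (+-monoˡ-≤ 1 (^-monoʳ-≤ 2 3≤e))))

r₃≡r₂⇒cleared-odd-τ : ∀ k l → r₃ (suc (double (suc l))) (double k) ≡ r₂ (suc (double (suc l))) (double k) →
                       3 * (9 ^ suc l + 1) ≡ 4 ^ k * (4 ^ suc l + 1) + 1
r₃≡r₂⇒cleared-odd-τ k l rewrite even-double k | even-suc-double (suc l) = λ eq → begin
  3 * (9 ^ suc l + 1)                                       ≡⟨ cong (λ x → 3 * (x + 1)) (^-double 3 (suc l)) ⟨
  3 * (3 ^ double (suc l) + 1)                              ≡⟨ cong (3 *_) eq ⟩
  3 * ((2 ^ double k * (2 ^ double (suc l) + 1) + 1) / 3)   ≡⟨ 3*[2^2k*[2^2l+1]+1]/3 k (suc l) ⟩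
  4 ^ k * (4 ^ suc l + 1) + 1                               ∎
  where open ≡-Reasoning

r₃≡r₂⇒cleared-even-τ : ∀ k l → r₃ (double (suc l)) (double k) ≡ r₂ (double (suc l)) (double k) →
                        3 * (2 * (3 * 9 ^ l) + 1) ≡ 4 ^ k * (4 ^ suc l + 1) + 1
r₃≡r₂⇒cleared-even-τ k l rewrite even-double k | even-double (suc l) = λ eq → begin
  3 * (2 * (3 * 9 ^ l) + 1)                                 ≡⟨ cong (λ x → 3 * (2 * (3 * x) + 1)) (^-double 3 l) ⟨
  3 * (2 * 3 ^ suc (double l) + 1)                          ≡⟨ cong (3 *_) eq ⟩
  3 * ((2 ^ double k * (2 ^ double (suc l) + 1) + 1) / 3)   ≡⟨ 3*[2^2k*[2^2l+1]+1]/3 k (suc l) ⟩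
  4 ^ k * (4 ^ suc l + 1) + 1                               ∎
  where open ≡-Reasoning

3[9^l+1]≢4xy+1 : ∀ l x y → 3 * (9 ^ l + 1) ≢ 4 * x * y + 1
3[9^l+1]≢4xy+1 l x y eq with [1+q]^n≡1[mod-q] 8 l
... | a , 9^l≡ = contradiction (m+kn≡o+ln⇒m≡o (3 + 12 * a) (2 * x * y) 2 (s≤s z≤n) ≤-refl (begin
  0 + (3 + 12 * a) * 2 ≡⟨ solve (a ∷ []) ⟩
  3 * (1 + 8 * a + 1)  ≡⟨ cong (λ z → 3 * (z + 1)) 9^l≡ ⟨
  3 * (9 ^ l + 1)      ≡⟨ eq ⟩
  4 * x * y + 1        ≡⟨ solve (x ∷ y ∷ []) ⟩
  1 + 2 * x * y * 2    ∎)) λ ()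
  where open ≡-Reasoning

3[6·9^l+1]≢16xy+1 : ∀ l x y → 3 * (2 * (3 * 9 ^ l) + 1) ≢ 4 * (4 * x) * y + 1
3[6·9^l+1]≢16xy+1 l x y eq with [1+q]^n≡1[mod-q] 8 l
... | a , 9^l≡ = contradiction (m+kn≡o+ln⇒m≡o (2 + 18 * a) (2 * x * y) 8 (m≤m+n 6 2) (m≤m+n 2 6) (begin
  5 + (2 + 18 * a) * 8            ≡⟨ solve (a ∷ []) ⟩
  3 * (2 * (3 * (1 + 8 * a)) + 1) ≡⟨ cong (λ z → 3 * (2 * (3 * z) + 1)) 9^l≡ ⟨
  3 * (2 * (3 * 9 ^ l) + 1)       ≡⟨ eq ⟩
  4 * (4 * x) * y + 1             ≡⟨ solve (x ∷ y ∷ []) ⟩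
  1 + 2 * x * y * 8               ∎)) λ ()
  where open ≡-Reasoning

3[6x+1]≡4[y+1]+1⇒9x≡2y+1 : ∀ x y → 3 * (2 * (3 * x) + 1) ≡ 4 * (y + 1) + 1 → 9 * x ≡ 2 * y + 1
3[6x+1]≡4[y+1]+1⇒9x≡2y+1 x y eq = *-cancelˡ-≡ (9 * x) (2 * y + 1) 2 (+-cancelʳ-≡ 3 _ _ (begin
  2 * (9 * x) + 3       ≡⟨ solve (x ∷ []) ⟩
  3 * (2 * (3 * x) + 1) ≡⟨ eq ⟩
  4 * (y + 1) + 1       ≡⟨ solve (y ∷ []) ⟩
  2 * (2 * y + 1) + 3   ∎))
  where open ≡-Reasoning

mainTheorem7 : (τ e : ℕ) → 2 ≤ τ → 1 ≤ e →
    (r₃ τ e ≡ r₂ τ e) ⇔ (e ≡ 1 ⊎ (e ≡ 2 × τ ≡ 2))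
mainTheorem7 τ e 2≤τ 1≤e with parity e | parity τ
... | twice zero          | _                   = contradiction 1≤e λ ()
... | twice (suc k)       | twice zero          = contradiction 2≤τ λ ()
... | twice (suc k)       | twice+1 zero        = contradiction 2≤τ λ { (s≤s ()) }
... | twice+1 zero        | _                   = mk⇔ (λ _ → inj₁ refl) (λ _ → refl)
... | twice (suc zero)    | twice (suc zero)    = mk⇔ (λ _ → inj₂ (refl , refl)) (λ _ → refl)
... | twice+1 (suc k)     | _                   =
  mk⇔ (⊥-elim ∘ r₃≢r₂-odd-e τ (suc (double (suc k))) (even-suc-double (suc k)) (s≤s (s≤s (s≤s z≤n))))
      λ { (inj₁ ()) ; (inj₂ (() , _)) }
... | twice (suc k)       | twice+1 (suc l)     =
  mk⇔ (⊥-elim ∘ 3[9^l+1]≢4xy+1 (suc l) (4 ^ k) _ ∘ r₃≡r₂⇒cleared-odd-τ (suc k) l)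
      λ { (inj₁ ()) ; (inj₂ (_ , ())) }
... | twice (suc (suc k)) | twice (suc l)       =
  mk⇔ (⊥-elim ∘ 3[6·9^l+1]≢16xy+1 l (4 ^ k) _ ∘ r₃≡r₂⇒cleared-even-τ (suc (suc k)) l)
      λ { (inj₁ ()) ; (inj₂ (() , _)) }
... | twice (suc zero)    | twice (suc (suc l)) =
  mk⇔ (⊥-elim ∘ <⇒≢ (2*4^n+1<9^n {2 + l} (s≤s (s≤s z≤n))) ∘ sym
               ∘ 3[6x+1]≡4[y+1]+1⇒9x≡2y+1 (9 ^ suc l) (4 ^ suc (suc l)) ∘ r₃≡r₂⇒cleared-even-τ 1 (suc l))
      λ { (inj₁ ()) ; (inj₂ (_ , ())) }
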